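{- Let $k\geq 3$ and $n\geq 4$, and write $n=2^tc$ with $t>0$ and $c$ odd. Let $(a_{0},a_{1},\dots,a_{n-2})$ be a negasymmetric $(n-1)$-tuple. Then $[a_0,a_1,\dots,a_{n-2},0]$ and, if $k$ is even, $[a_0,a_1,\dots,a_{n-2},k/2]$ are negasymmetric circuits in $\mathcal{C}_k(n-1)$. Moreover, if $x\in\{0,k/2\}$ (with $x=k/2$ only when $k$ is even), $a_{n-1}:=x$, and $[a_0,a_1,\dots,a_{n-2},x]$ contains a negasymmetric $n$-tuple, then: (i) $[a_0,\dots,a_{n-2},x]$ has odd period dividing $c$; (ii) $[a_0,\dots,a_{n-2},x]$ contains precisely one negasymmetric $n$-tuple; (iii) $a_{c-1}=x$, $(a_0,a_1,\dots,a_{n-1})$ equals the concatenation of $2^t$ copies of $(a_0,a_1,\dots,a_{c-1})$, and $[a_0,a_1,\dots,a_{c-1}]$ is a negasymmetric circuit containing a single negasymmetric $c$-tuple.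
   Context: Tuples are $k$-ary (entries in $\mathbb{Z}_k$), negation is modulo $k$, $\mathbf{u}^R$ is the reverse of $\mathbf{u}$; a tuple $\mathbf{u}$ is negasymmetric if $\mathbf{u}=-\mathbf{u}^R$. The pseudoweight of $a\in\mathbb{Z}_k$ is $a$ if $a\ne0$ and $k/2$ if $a=0$, and of a tuple the sum over its entries. For $N\ge1$, $B_k(N-1)$ is the de Bruijn digraph with vertices the $k$-ary $(N-1)$-tuples and edges the $k$-ary $N$-tuples $(a_0,\dots,a_{N-1})$ from $(a_0,\dots,a_{N-2})$ to $(a_1,\dots,a_{N-1})$; $H_k(N-1)$ is its subgraph of edges of pseudoweight exactly $kN/2$. For an $N$-tuple $(a_0,\dots,a_{N-1})$, with $p$ the least positive $d$ such that $a_i=a_{(i+d)\bmod N}$ for all $i$, $[a_0,\dots,a_{N-1}]$ is the circuit in $B_k(N-1)$ whose edges (the $N$-tuples it contains) are the $p$ cyclic shifts $(a_j,\dots,a_{j+N-1})$ (indices mod $N$), $0\le j<p$; $p$ is its period. $\mathcal{C}_k(n-1)$ is the set of such circuits arising from edges of $H_k(n-1)$. A circuit is negasymmetric if it contains edges $\mathbf a,\mathbf b$ (not necessarily distinct) with $\mathbf a=-\mathbf b^R$. -}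

module Defs where

open import Data.Nat using (ℕ; zero; suc; _+_; _*_; _<_; _≤_)
open import Data.Nat.DivMod using (_%_; m%n<n)
open import Data.Fin using (Fin; toℕ; fromℕ<)
open import Data.Vec using (Vec; lookup; tabulate; map; reverse; sum)
open import Data.Product using (Σ; _×_; ∃; ∃-syntax)
open import Relation.Binary.PropositionalEquality using (_≡_)
open import Relation.Nullary using (¬_)
open import Function.Bundles using (_⇔_)

negₖ : ∀ {k} → Fin k → Fin k
negₖ {suc m} a = fromℕ< (m%n<n (suc m Data.Nat.∸ toℕ a) (suc m))

negT : ∀ {k N} → Vec (Fin k) N → Vec (Fin k) N
negT = map negₖ

NegaSym : ∀ {k N} → Vec (Fin k) N → Set
NegaSym u = u ≡ negT (reverse u)

-- twice the pseudoweight of an entry (pseudoweight of 0 is k/2; doubled to stay in ℕ)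
pw2 : ∀ {k} → Fin k → ℕ
pw2 {k} Fin.zero = k
pw2 (Fin.suc i) = 2 * suc (toℕ i)

pw2T : ∀ {k N} → Vec (Fin k) N → ℕ
pw2T u = sum (map pw2 u)

idx : ∀ {N} → Fin N → ℕ → Fin N
idx {suc m} i d = fromℕ< (m%n<n (toℕ i + d) (suc m))

shift : ∀ {A : Set} {N} → Vec A N → ℕ → Vec A N
shift a j = tabulate (λ i → lookup a (idx i j))

IsShiftInvariant : ∀ {A : Set} {N} → Vec A N → ℕ → Set
IsShiftInvariant {N = N} a d = (i : Fin N) → lookup a i ≡ lookup a (idx i d)

IsPeriod : ∀ {A : Set} {N} → Vec A N → ℕ → Set
IsPeriod a p = (0 < p) × IsShiftInvariant a p
               × ((d : ℕ) → 0 < d → d < p → ¬ IsShiftInvariant a d)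

-- e is an edge of the circuit [a]: e = one of the p shifts (a_j..a_{j+N-1}), 0 ≤ j < p
InCircuit : ∀ {A : Set} {N} → Vec A N → Vec A N → Set
InCircuit e a = Σ ℕ λ p → IsPeriod a p × Σ ℕ λ j → j < p × e ≡ shift a j

SameCircuit : ∀ {A : Set} {N} → Vec A N → Vec A N → Set
SameCircuit {A} {N} a b = (e : Vec A N) → InCircuit e a ⇔ InCircuit e b

-- [a] ∈ C_k(n-1): [a] = [e] for some edge e of H_k(n-1)  (pseudoweight of e = kn/2)
InC : ∀ {k N} → (n : ℕ) → Vec (Fin k) N → Set
InC {k} {N} n a = Σ (Vec (Fin k) N) λ e → pw2T e ≡ k * n × SameCircuit e a

NegaSymCircuit : ∀ {k N} → Vec (Fin k) N → Set
NegaSymCircuit {k} {N} a =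
  Σ (Vec (Fin k) N) λ e → Σ (Vec (Fin k) N) λ f →
    InCircuit e a × InCircuit f a × e ≡ negT (reverse f)

ContainsNegaSym : ∀ {k N} → Vec (Fin k) N → Set
ContainsNegaSym {k} {N} a = Σ (Vec (Fin k) N) λ e → InCircuit e a × NegaSym e

ExactlyOneNegaSym : ∀ {k N} → Vec (Fin k) N → Set
ExactlyOneNegaSym {k} {N} a =
  Σ (Vec (Fin k) N) λ e → InCircuit e a × NegaSym e
    × ((f : Vec (Fin k) N) → InCircuit f a → NegaSym f → f ≡ e)

open import Data.Nat.Divisibility using (_∣_)

Even : ℕ → Set
Even m = 2 ∣ m

Odd : ℕ → Set
Odd m = ¬ (2 ∣ m)

{-# OPTIONS --safe #-}
module Submission where

-- Extend a tuple v of length N periodically to ℤ, v ! z = v (z mod N). The shift of v by j is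
-- negasymmetric exactly when this extension G satisfies G (s - z) = - G z about the centre s = 2j - 1.
-- For v = (a_0, …, a_(n-2), x) with a negasymmetric and x = - x this mirror symmetry holds about
-- s = -2, so the shift of v by -1 (modulo its period) is the negated reversal of v and the circuit is
-- negasymmetric. If moreover the shift by j is negasymmetric, the mirror symmetries about -2 and
-- 2j - 1 compose to the translation by 2j + 1, so the least period p divides both the odd number
-- 2j + 1 and n = 2^t c. Hence p is odd and divides c, the extension is c-periodic, which makes the
-- tuple 2^t copies of its first c entries, and 2j + 1 ≡ 0 (mod p) determines j < p, so the
-- negasymmetric tuple is unique. The pseudoweight claim is the pairing pw y + pw (- y) = k.

open import Defs
open import Data.Nat using (ℕ; _∸_; _*_; _^_; _≤_; _<_)
open import Data.Nat.Divisibility using (_∣_)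
open import Data.Fin using (Fin; toℕ)
open import Data.Vec using (Vec; _∷ʳ_; toList)
open import Data.List using (concat; replicate; last)
open import Data.Maybe using (just)
open import Data.Product using (Σ; _×_)
open import Data.Sum using (_⊎_)
open import Relation.Binary.PropositionalEquality using (_≡_)

open import Data.Nat as ℕ using (zero; suc; _⊔_; NonZero)
import Data.Nat.Properties as ℕ
import Data.Nat.DivMod as ℕ
open import Data.Nat.Divisibility
  using (divides; >⇒∤; m%n≡0⇒n∣m; ∣⇒≤; ∣-trans; ∣1⇒≡1; ∣m+n∣m⇒∣n; 0∣⇒≡0)
open import Data.Nat.Coprimality using (Coprime; coprime-divisor)
open import Data.Nat.Induction using (<-rec)
import Data.Nat.Tactic.RingSolver as ℕ-Solver
open import Data.Integer as ℤ using (ℤ; +_; -[1+_]; ∣_∣)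
import Data.Integer.Properties as ℤ
open import Data.Integer.DivMod using (n%ℕd<d; a≡a%ℕn+[a/ℕn]*n)
open import Data.Integer.Tactic.RingSolver using (solve-∀)
open import Data.Fin as Fin using (fromℕ<; fromℕ; inject₁; opposite)
import Data.Fin.Properties as Fin
open import Data.Fin.Relation.Unary.Top using (view; ‵fromℕ; ‵inject₁)
open import Data.Vec as Vec using ([]; _∷_; lookup; tabulate; reverse)
import Data.Vec.Properties as Vec
open import Data.Vec.Relation.Binary.Pointwise.Extensional using (ext; Pointwise-≡⇒≡)
open import Data.List using (_∷_; _++_; applyUpTo)
open import Data.Product using (_,_; ∃; ∃₂)
open import Data.Sum using (inj₁; inj₂)
open import Function using (_∘_; id)
open import Function.Bundles using (mk⇔)
open import Relation.Nullary using (¬_; contradiction; yes; no)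
open import Relation.Nullary.Decidable using (_×-dec_)
open import Relation.Unary using (Decidable)
open import Relation.Binary.Definitions using (DecidableEquality; tri<; tri≈; tri>)
open import Relation.Binary.PropositionalEquality
  using (refl; sym; trans; cong; cong₂; subst; _≗_; module ≡-Reasoning)

minimal-witness : ∀ {P : ℕ → Set} → Decidable P → ∀ n → P n →
                  ∃ λ m → P m × (∀ d → d < m → ¬ P d)
minimal-witness {P} P? = <-rec _ search
  where
  search : ∀ n → (∀ {d} → d < n → P d → ∃ λ m → P m × (∀ d → d < m → ¬ P d)) → P n →
           ∃ λ m → P m × (∀ d → d < m → ¬ P d)
  search n smaller Pn with Fin.any? (λ (i : Fin n) → P? (toℕ i))
  ... | yes (i , Pi) = smaller (Fin.toℕ<n i) Pi
  ... | no ∄ = n , Pn , λ d d<n Pd → ∄ (fromℕ< d<n , subst P (sym (Fin.toℕ-fromℕ< d<n)) Pd)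

∣∧<⇒≡0 : ∀ {m n} → m ∣ n → n < m → n ≡ 0
∣∧<⇒≡0 {n = zero}  _   _   = refl
∣∧<⇒≡0 {n = suc _} m∣n n<m = contradiction m∣n (>⇒∤ n<m)

remainder-unique : ∀ {M r r′} q q′ → r < M → r′ < M →
                   + r ℤ.+ q ℤ.* + M ≡ + r′ ℤ.+ q′ ℤ.* + M → r ≡ r′
remainder-unique {M} {r} {r′} q q′ r<M r′<M eq =
  ℤ.+-injective (ℤ.i-j≡0⇒i≡j (+ r) (+ r′) (ℤ.∣i∣≡0⇒i≡0 (∣∧<⇒≡0 M∣∣d∣ ∣d∣<M)))
  where
  d = + r ℤ.- + r′
  d≡ : d ≡ (q′ ℤ.- q) ℤ.* + M
  d≡ = begin
    d
      ≡⟨ rearrange (+ r) (+ r′) q q′ (+ M) ⟩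
    (+ r ℤ.+ q ℤ.* + M) ℤ.- (+ r′ ℤ.+ q′ ℤ.* + M) ℤ.+ (q′ ℤ.- q) ℤ.* + M
      ≡⟨ cong (ℤ._+ (q′ ℤ.- q) ℤ.* + M) (ℤ.i≡j⇒i-j≡0 eq) ⟩
    + 0 ℤ.+ (q′ ℤ.- q) ℤ.* + M
      ≡⟨ ℤ.+-identityˡ _ ⟩
    (q′ ℤ.- q) ℤ.* + M
      ∎
    where
    open ≡-Reasoning
    rearrange : ∀ r r′ q q′ M → r ℤ.- r′ ≡ (r ℤ.+ q ℤ.* M) ℤ.- (r′ ℤ.+ q′ ℤ.* M) ℤ.+ (q′ ℤ.- q) ℤ.* M
    rearrange = solve-∀
  M∣∣d∣ : M ∣ ∣ d ∣
  M∣∣d∣ = divides ∣ q′ ℤ.- q ∣ (trans (cong ∣_∣ d≡) (ℤ.abs-* (q′ ℤ.- q) (+ M)))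
  ∣d∣<M : ∣ d ∣ < M
  ∣d∣<M = ℕ.≤-<-trans (subst (λ w → ∣ w ∣ ≤ r ⊔ r′) (sym (ℤ.m-n≡m⊖n r r′)) (ℤ.∣m⊝n∣≤m⊔n r r′))
                      (ℕ.⊔-lub r<M r′<M)

decompose : ∀ {n} .{{_ : NonZero n}} z → ∃₂ λ (i : Fin n) q → z ≡ + toℕ i ℤ.+ q ℤ.* + n
decompose {n} z = fromℕ< (n%ℕd<d z n) , z ℤ./ℕ n ,
  trans (a≡a%ℕn+[a/ℕn]*n z n) (cong (λ r → + r ℤ.+ (z ℤ./ℕ n) ℤ.* + n) (sym (Fin.toℕ-fromℕ< _)))

-- Periodic and mirror-symmetric functions on ℤ

module _ {X : Set} where

  Periodic : (ℤ → X) → ℤ → Set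
  Periodic G d = ∀ z → G (z ℤ.+ d) ≡ G z

  periodic-*ℕ : ∀ {G d} → Periodic G d → ∀ n z → G (z ℤ.+ + n ℤ.* d) ≡ G z
  periodic-*ℕ {G} {d} per zero    z = cong G (no-step z d)
    where
    no-step : ∀ z d → z ℤ.+ + 0 ℤ.* d ≡ z
    no-step = solve-∀
  periodic-*ℕ {G} {d} per (suc n) z = begin
    G (z ℤ.+ + suc n ℤ.* d)     ≡⟨ cong G (one-more-step z (+ n) d) ⟩
    G (z ℤ.+ + n ℤ.* d ℤ.+ d)   ≡⟨ per _ ⟩
    G (z ℤ.+ + n ℤ.* d)         ≡⟨ periodic-*ℕ per n z ⟩
    G z                         ∎
    where
    open ≡-Reasoning
    one-more-step : ∀ z n d → z ℤ.+ (+ 1 ℤ.+ n) ℤ.* d ≡ z ℤ.+ n ℤ.* d ℤ.+ d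
    one-more-step = solve-∀

  periodic-* : ∀ {G d} → Periodic G d → ∀ q z → G (z ℤ.+ q ℤ.* d) ≡ G z
  periodic-*         per (+ n)    z = periodic-*ℕ per n z
  periodic-* {G} {d} per -[1+ n ] z = begin
    G (z ℤ.+ -[1+ n ] ℤ.* d)                     ≡⟨ periodic-*ℕ per (suc n) _ ⟨
    G (z ℤ.+ -[1+ n ] ℤ.* d ℤ.+ + suc n ℤ.* d)   ≡⟨ cong G (cancel z (+ suc n) d) ⟩
    G z                                          ∎
    where
    open ≡-Reasoning
    cancel : ∀ z a d → z ℤ.+ (ℤ.- a) ℤ.* d ℤ.+ a ℤ.* d ≡ z
    cancel = solve-∀

  periodic-cong : ∀ {G d} → Periodic G d → ∀ q z′ {z} → z ≡ z′ ℤ.+ q ℤ.* d → G z ≡ G z′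
  periodic-cong per q z′ refl = periodic-* per q z′

  periodic-∣ : ∀ {G p d} → Periodic G (+ p) → p ∣ d → Periodic G (+ d)
  periodic-∣ {G} per (divides q refl) z =
    trans (cong (λ w → G (z ℤ.+ w)) (ℤ.pos-* q _)) (periodic-* per (+ q) z)

  periodic-≗ : ∀ {G H d} → G ≗ H → Periodic G d → Periodic H d
  periodic-≗ G≗H per z = trans (sym (G≗H _)) (trans (per z) (G≗H z))

record MirrorSymmetric {X : Set} (f : X → X) (G : ℤ → X) (s : ℤ) : Set where
  constructor mirror-symmetric
  field
    reflect : ∀ z → G (s ℤ.- z) ≡ f (G z)

open MirrorSymmetric public

module _ {X : Set} {f : X → X} where

  mirrors⇒periodic : ∀ {G s s′} → MirrorSymmetric f G s → MirrorSymmetric f G s′ → Periodic G (s ℤ.- s′)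
  mirrors⇒periodic {G} {s} {s′} mirror mirror′ z = begin
    G (z ℤ.+ (s ℤ.- s′))    ≡⟨ cong G (reflect-twice z s s′) ⟩
    G (s ℤ.- (s′ ℤ.- z))    ≡⟨ reflect mirror (s′ ℤ.- z) ⟩
    f (G (s′ ℤ.- z))        ≡⟨ reflect mirror′ (s′ ℤ.- z) ⟨
    G (s′ ℤ.- (s′ ℤ.- z))   ≡⟨ cong G (reflect-back z s′) ⟩
    G z                     ∎
    where
    open ≡-Reasoning
    reflect-twice : ∀ z s s′ → z ℤ.+ (s ℤ.- s′) ≡ s ℤ.- (s′ ℤ.- z)
    reflect-twice = solve-∀
    reflect-back : ∀ z s′ → s′ ℤ.- (s′ ℤ.- z) ≡ z
    reflect-back = solve-∀

  mirror-≗ : ∀ {G H s} → G ≗ H → MirrorSymmetric f G s → MirrorSymmetric f H s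
  mirror-≗ G≗H mirror .reflect z = trans (sym (G≗H _)) (trans (reflect mirror z) (cong f (G≗H z)))

lookup-∷ʳ-inject₁ : ∀ {X : Set} {n} (xs : Vec X n) x i → lookup (xs ∷ʳ x) (inject₁ i) ≡ lookup xs i
lookup-∷ʳ-inject₁ (_ ∷ _)  _ Fin.zero    = refl
lookup-∷ʳ-inject₁ (_ ∷ xs) x (Fin.suc i) = lookup-∷ʳ-inject₁ xs x i

lookup-∷ʳ-fromℕ : ∀ {X : Set} {n} (xs : Vec X n) x → lookup (xs ∷ʳ x) (fromℕ n) ≡ x
lookup-∷ʳ-fromℕ []       _ = refl
lookup-∷ʳ-fromℕ (_ ∷ xs) x = lookup-∷ʳ-fromℕ xs x

lookup-reverse-opposite : ∀ {X : Set} {n} (xs : Vec X n) i →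
                          lookup (reverse xs) (opposite i) ≡ lookup xs i
lookup-reverse-opposite (x ∷ xs) Fin.zero = begin
  lookup (reverse (x ∷ xs)) (fromℕ _)   ≡⟨ cong (λ w → lookup w (fromℕ _)) (Vec.reverse-∷ x xs) ⟩
  lookup (reverse xs ∷ʳ x) (fromℕ _)    ≡⟨ lookup-∷ʳ-fromℕ (reverse xs) x ⟩
  x                                     ∎
  where open ≡-Reasoning
lookup-reverse-opposite (x ∷ xs) (Fin.suc i) = begin
  lookup (reverse (x ∷ xs)) (inject₁ (opposite i))   ≡⟨ cong (λ w → lookup w _) (Vec.reverse-∷ x xs) ⟩
  lookup (reverse xs ∷ʳ x) (inject₁ (opposite i))    ≡⟨ lookup-∷ʳ-inject₁ (reverse xs) x _ ⟩
  lookup (reverse xs) (opposite i)                   ≡⟨ lookup-reverse-opposite xs i ⟩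
  lookup xs i                                        ∎
  where open ≡-Reasoning

lookup-reverse : ∀ {X : Set} {n} (xs : Vec X n) i → lookup (reverse xs) i ≡ lookup xs (opposite i)
lookup-reverse xs i = begin
  lookup (reverse xs) i                         ≡⟨ cong (lookup (reverse xs)) (Fin.opposite-involutive i) ⟨
  lookup (reverse xs) (opposite (opposite i))   ≡⟨ lookup-reverse-opposite xs (opposite i) ⟩
  lookup xs (opposite i)                        ∎
  where open ≡-Reasoning

opposite-+ : ∀ {n} (i : Fin n) → + n ≡ + toℕ (opposite i) ℤ.+ (+ 1 ℤ.+ + toℕ i)
opposite-+ i =
  cong +_ (sym (trans (cong (ℕ._+ suc (toℕ i)) (Fin.opposite-prop i)) (ℕ.m∸n+n≡m (Fin.toℕ<n i))))

-- The periodic extension of a tuple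

infixl 5 _!_

_!_ : ∀ {X : Set} {m} → Vec X (suc m) → ℤ → X
_!_ {m = m} v z = lookup v (fromℕ< (n%ℕd<d z (suc m)))

module _ {X : Set} {m : ℕ} (v : Vec X (suc m)) where

  private
    M = suc m

  !-periodic : Periodic (v !_) (+ M)
  !-periodic z = cong (lookup v) (Fin.fromℕ<-cong _ _ same-remainder _ _)
    where
    q = z ℤ./ℕ M
    z+M≡ : z ℤ.+ + M ≡ + (z ℤ.%ℕ M) ℤ.+ (q ℤ.+ + 1) ℤ.* + M
    z+M≡ = trans (cong (ℤ._+ + M) (a≡a%ℕn+[a/ℕn]*n z M)) (next-quotient (+ (z ℤ.%ℕ M)) q (+ M))
      where
      next-quotient : ∀ r q M → r ℤ.+ q ℤ.* M ℤ.+ M ≡ r ℤ.+ (q ℤ.+ + 1) ℤ.* M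
      next-quotient = solve-∀
    same-remainder : (z ℤ.+ + M) ℤ.%ℕ M ≡ z ℤ.%ℕ M
    same-remainder = remainder-unique ((z ℤ.+ + M) ℤ./ℕ M) (q ℤ.+ + 1)
                                      (n%ℕd<d (z ℤ.+ + M) M) (n%ℕd<d z M)
                                      (trans (sym (a≡a%ℕn+[a/ℕn]*n (z ℤ.+ + M) M)) z+M≡)

  lookup-! : ∀ i → lookup v i ≡ v ! + toℕ i
  lookup-! i = cong (lookup v) (sym (trans
    (Fin.fromℕ<-cong _ _ (ℕ.m<n⇒m%n≡m (Fin.toℕ<n i)) _ (Fin.toℕ<n i)) (Fin.fromℕ<-toℕ i _)))

  !-last : v ! ℤ.- + 1 ≡ lookup v (fromℕ m)
  !-last = begin
    v ! ℤ.- + 1           ≡⟨ !-periodic (ℤ.- + 1) ⟨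
    v ! + m               ≡⟨ cong (λ r → v ! + r) (Fin.toℕ-fromℕ m) ⟨
    v ! + toℕ (fromℕ m)   ≡⟨ lookup-! (fromℕ m) ⟨
    lookup v (fromℕ m)    ∎
    where open ≡-Reasoning

  !-opposite : ∀ i → v ! ℤ.- + 1 ℤ.- + toℕ i ≡ v ! + toℕ (opposite i)
  !-opposite i = periodic-cong !-periodic (ℤ.- + 1) (+ toℕ (opposite i))
                               (wrap (+ toℕ (opposite i)) (+ toℕ i) {+ M} (opposite-+ i))
    where
    wrap : ∀ o r {n} → n ≡ o ℤ.+ (+ 1 ℤ.+ r) → ℤ.- + 1 ℤ.- r ≡ o ℤ.+ ℤ.- + 1 ℤ.* n
    wrap o r refl = solve o r
      where
      solve : ∀ o r → ℤ.- + 1 ℤ.- r ≡ o ℤ.+ ℤ.- + 1 ℤ.* (o ℤ.+ (+ 1 ℤ.+ r))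
      solve = solve-∀

module _ {X : Set} {m : ℕ} (v : Vec X (suc m)) where

  private
    M = suc m

  lookup-shift : ∀ j i → lookup (shift v j) i ≡ v ! + toℕ i ℤ.+ + j
  lookup-shift j i = Vec.lookup∘tabulate (λ i → lookup v (idx i j)) i

  shift-! : ∀ j z → shift v j ! z ≡ v ! z ℤ.+ + j
  shift-! j z with decompose {M} z
  ... | i , q , refl = begin
    shift v j ! + toℕ i ℤ.+ q ℤ.* + M   ≡⟨ periodic-* (!-periodic (shift v j)) q (+ toℕ i) ⟩
    shift v j ! + toℕ i                 ≡⟨ lookup-! (shift v j) i ⟨
    lookup (shift v j) i                ≡⟨ lookup-shift j i ⟩
    v ! + toℕ i ℤ.+ + j                 ≡⟨ periodic-cong (!-periodic v) q (+ toℕ i ℤ.+ + j)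
                                           (swap (+ toℕ i) q (+ M) (+ j)) ⟨
    v ! + toℕ i ℤ.+ q ℤ.* + M ℤ.+ + j   ∎
    where
    open ≡-Reasoning
    swap : ∀ r q M j → r ℤ.+ q ℤ.* M ℤ.+ j ≡ r ℤ.+ j ℤ.+ q ℤ.* M
    swap = solve-∀

  shiftInvariant⇒periodic : ∀ {d} → IsShiftInvariant v d → Periodic (v !_) (+ d)
  shiftInvariant⇒periodic {d} inv z = begin
    v ! z ℤ.+ + d   ≡⟨ shift-! d z ⟨
    shift v d ! z   ≡⟨ cong (_! z) shift-v-d≡v ⟩
    v ! z           ∎
    where
    open ≡-Reasoning
    shift-v-d≡v : shift v d ≡ v
    shift-v-d≡v = Pointwise-≡⇒≡ (ext λ i → trans (lookup-shift d i) (sym (inv i)))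

  periodic⇒shiftInvariant : ∀ {d} → Periodic (v !_) (+ d) → IsShiftInvariant v d
  periodic⇒shiftInvariant per i = trans (lookup-! v i) (sym (per (+ toℕ i)))

  period-exists : DecidableEquality X → ∃ (IsPeriod v)
  period-exists _≟_
    with minimal-witness positive-invariant? M (ℕ.z<s , periodic⇒shiftInvariant (!-periodic v))
    where
    positive-invariant? : Decidable (λ d → 0 < d × IsShiftInvariant v d)
    positive-invariant? d = (0 ℕ.<? d) ×-dec Fin.all? (λ i → lookup v i ≟ lookup v (idx i d))
  ... | p , (0<p , inv) , below = p , 0<p , inv , λ d 0<d d<p inv′ → below d d<p (0<d , inv′)

  period-unique : ∀ {p p′} → IsPeriod v p → IsPeriod v p′ → p ≡ p′
  period-unique {p} {p′} (0<p , inv , least) (0<p′ , inv′ , least′) with ℕ.<-cmp p p′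
  ... | tri< p<p′ _ _ = contradiction inv (least′ p 0<p p<p′)
  ... | tri≈ _ p≡p′ _ = p≡p′
  ... | tri> _ _ p′<p = contradiction inv′ (least p′ 0<p′ p′<p)

  period-∣ : ∀ {p d} → IsPeriod v p → Periodic (v !_) (+ d) → p ∣ d
  period-∣ {p@(suc _)} {d} (_ , p-inv , least) d-per = m%n≡0⇒n∣m d p r≡0
    where
    r = d ℕ.% p
    q = d ℕ./ p
    d≡ : + d ≡ + r ℤ.+ + q ℤ.* + p
    d≡ = trans (cong +_ (ℕ.m≡m%n+[m/n]*n d p)) (cong (λ w → + r ℤ.+ w) (ℤ.pos-* q p))
    r-per : Periodic (v !_) (+ r)
    r-per z = trans (periodic-cong (shiftInvariant⇒periodic p-inv) (ℤ.- + q) (z ℤ.+ + d)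
                                   (drop-multiple z (+ r) (+ q) (+ p) d≡))
                    (d-per z)
      where
      drop-multiple : ∀ z r q p {d} → d ≡ r ℤ.+ q ℤ.* p → z ℤ.+ r ≡ z ℤ.+ d ℤ.+ (ℤ.- q) ℤ.* p
      drop-multiple z r q p refl = solve z r q p
        where
        solve : ∀ z r q p → z ℤ.+ r ≡ z ℤ.+ (r ℤ.+ q ℤ.* p) ℤ.+ (ℤ.- q) ℤ.* p
        solve = solve-∀
    r≡0 : r ≡ 0
    r≡0 = ℕ.n≤0⇒n≡0 (ℕ.≮⇒≥ λ 0<r → least r 0<r (ℕ.m%n<n d p) (periodic⇒shiftInvariant r-per))

  mirror-from-lookup : ∀ {f s} → (∀ i → v ! s ℤ.- + toℕ i ≡ f (lookup v i)) → MirrorSymmetric f (v !_) s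
  mirror-from-lookup {f} {s} reflect-lookup .reflect z with decompose {M} z
  ... | i , q , refl = begin
    v ! s ℤ.- (+ toℕ i ℤ.+ q ℤ.* + M)   ≡⟨ periodic-cong (!-periodic v) (ℤ.- q) (s ℤ.- + toℕ i)
                                           (distribute s (+ toℕ i) q (+ M)) ⟩
    v ! s ℤ.- + toℕ i                   ≡⟨ reflect-lookup i ⟩
    f (lookup v i)                      ≡⟨ cong f (lookup-! v i) ⟩
    f (v ! + toℕ i)                     ≡⟨ cong f (periodic-* (!-periodic v) q (+ toℕ i)) ⟨
    f (v ! + toℕ i ℤ.+ q ℤ.* + M)       ∎
    where
    open ≡-Reasoning
    distribute : ∀ s r q M → s ℤ.- (r ℤ.+ q ℤ.* M) ≡ s ℤ.- r ℤ.+ (ℤ.- q) ℤ.* M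
    distribute = solve-∀

shiftInvariant-≗ : ∀ {X : Set} {m m′} (v : Vec X (suc m)) (w : Vec X (suc m′)) {d} → (v !_) ≗ (w !_) →
                   IsShiftInvariant v d → IsShiftInvariant w d
shiftInvariant-≗ v w v≗w inv = periodic⇒shiftInvariant w (periodic-≗ v≗w (shiftInvariant⇒periodic v inv))

isPeriod-≗ : ∀ {X : Set} {m m′} (v : Vec X (suc m)) (w : Vec X (suc m′)) {p} → (v !_) ≗ (w !_) →
             IsPeriod v p → IsPeriod w p
isPeriod-≗ v w v≗w (0<p , inv , least) =
  0<p , shiftInvariant-≗ v w v≗w inv ,
  λ d 0<d d<p → least d 0<d d<p ∘ shiftInvariant-≗ w v (λ z → sym (v≗w z))

-- Negasymmetry as a mirror symmetry

module _ {k : ℕ} where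

  lookup-negT-reverse : ∀ {n} (f : Vec (Fin k) n) i →
                        lookup (negT (reverse f)) i ≡ negₖ (lookup f (opposite i))
  lookup-negT-reverse f i = trans (Vec.lookup-map i negₖ (reverse f)) (cong negₖ (lookup-reverse f i))

  negaSym-lookup : ∀ {n} {e : Vec (Fin k) n} → NegaSym e → ∀ i → lookup e i ≡ negₖ (lookup e (opposite i))
  negaSym-lookup {e = e} ns i = trans (cong (λ w → lookup w i) ns) (lookup-negT-reverse e i)

module _ {k m : ℕ} where

  private
    M = suc m

  mirror-pair⇒≡negT-reverse : (e f : Vec (Fin k) M) → (∀ z → e ! ℤ.- + 1 ℤ.- z ≡ negₖ (f ! z)) →
                              e ≡ negT (reverse f)
  mirror-pair⇒≡negT-reverse e f paired = Pointwise-≡⇒≡ (ext λ i → begin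
    lookup e i                           ≡⟨ lookup-! e i ⟩
    e ! + toℕ i                          ≡⟨ cong ((e !_) ∘ +_ ∘ toℕ) (Fin.opposite-involutive i) ⟨
    e ! + toℕ (opposite (opposite i))    ≡⟨ !-opposite e (opposite i) ⟨
    e ! ℤ.- + 1 ℤ.- + toℕ (opposite i)   ≡⟨ paired (+ toℕ (opposite i)) ⟩
    negₖ (f ! + toℕ (opposite i))        ≡⟨ cong negₖ (lookup-! f (opposite i)) ⟨
    negₖ (lookup f (opposite i))         ≡⟨ lookup-negT-reverse f i ⟨
    lookup (negT (reverse f)) i          ∎)
    where open ≡-Reasoning

  negaSym⇒mirror : ∀ {e : Vec (Fin k) M} → NegaSym e → MirrorSymmetric negₖ (e !_) (ℤ.- + 1)
  negaSym⇒mirror {e} ns = mirror-from-lookup e λ i → begin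
    e ! ℤ.- + 1 ℤ.- + toℕ i                   ≡⟨ !-opposite e i ⟩
    e ! + toℕ (opposite i)                    ≡⟨ lookup-! e (opposite i) ⟨
    lookup e (opposite i)                     ≡⟨ negaSym-lookup ns (opposite i) ⟩
    negₖ (lookup e (opposite (opposite i)))   ≡⟨ cong (negₖ ∘ lookup e) (Fin.opposite-involutive i) ⟩
    negₖ (lookup e i)                         ∎
    where open ≡-Reasoning

  negaSym-shift⇒mirror : ∀ (v : Vec (Fin k) M) j → NegaSym (shift v j) →
                         MirrorSymmetric negₖ (v !_) (ℤ.- + 1 ℤ.+ + j ℤ.+ + j)
  negaSym-shift⇒mirror v j ns .reflect z = begin
    v ! (ℤ.- + 1 ℤ.+ + j ℤ.+ + j) ℤ.- z   ≡⟨ cong (v !_) (recentre z (+ j)) ⟩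
    v ! ℤ.- + 1 ℤ.- (z ℤ.- + j) ℤ.+ + j   ≡⟨ shift-! v j (ℤ.- + 1 ℤ.- (z ℤ.- + j)) ⟨
    shift v j ! ℤ.- + 1 ℤ.- (z ℤ.- + j)   ≡⟨ reflect (negaSym⇒mirror ns) (z ℤ.- + j) ⟩
    negₖ (shift v j ! z ℤ.- + j)          ≡⟨ cong negₖ (shift-! v j (z ℤ.- + j)) ⟩
    negₖ (v ! z ℤ.- + j ℤ.+ + j)          ≡⟨ cong (λ w → negₖ (v ! w)) (cancel z (+ j)) ⟩
    negₖ (v ! z)                          ∎
    where
    open ≡-Reasoning
    recentre : ∀ z j → (ℤ.- + 1 ℤ.+ j ℤ.+ j) ℤ.- z ≡ ℤ.- + 1 ℤ.- (z ℤ.- j) ℤ.+ j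
    recentre = solve-∀
    cancel : ∀ z j → z ℤ.- j ℤ.+ j ≡ z
    cancel = solve-∀

  mirror⇒negaSym-shift : ∀ (v : Vec (Fin k) M) j → MirrorSymmetric negₖ (v !_) (ℤ.- + 1 ℤ.+ + j ℤ.+ + j) →
                         NegaSym (shift v j)
  mirror⇒negaSym-shift v j mirror = mirror-pair⇒≡negT-reverse (shift v j) (shift v j) λ z → begin
    shift v j ! ℤ.- + 1 ℤ.- z                       ≡⟨ shift-! v j (ℤ.- + 1 ℤ.- z) ⟩
    v ! ℤ.- + 1 ℤ.- z ℤ.+ + j                       ≡⟨ cong (v !_) (recentre z (+ j)) ⟩
    v ! (ℤ.- + 1 ℤ.+ + j ℤ.+ + j) ℤ.- (z ℤ.+ + j)   ≡⟨ reflect mirror (z ℤ.+ + j) ⟩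
    negₖ (v ! z ℤ.+ + j)                            ≡⟨ cong negₖ (shift-! v j z) ⟨
    negₖ (shift v j ! z)                            ∎
    where
    open ≡-Reasoning
    recentre : ∀ z j → ℤ.- + 1 ℤ.- z ℤ.+ j ≡ (ℤ.- + 1 ℤ.+ j ℤ.+ j) ℤ.- (z ℤ.+ j)
    recentre = solve-∀

  -- The centre is written -1 + t because t modulo the period is then the shift that is paired with
  -- the tuple itself.
  mirror⇒negaSymCircuit : ∀ (v : Vec (Fin k) M) t → MirrorSymmetric negₖ (v !_) (ℤ.- + 1 ℤ.+ t) →
                          NegaSymCircuit v
  mirror⇒negaSymCircuit v t mirror with period-exists v Fin._≟_
  ... | p@(suc _) , isPeriod@(_ , p-inv , _) with decompose {p} t
  ...   | j , q , refl = shift v (toℕ j) , shift v 0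
                       , (p , isPeriod , toℕ j , Fin.toℕ<n j , refl) , (p , isPeriod , 0 , ℕ.z<s , refl)
                       , mirror-pair⇒≡negT-reverse (shift v (toℕ j)) (shift v 0) paired
    where
    paired : ∀ z → shift v (toℕ j) ! ℤ.- + 1 ℤ.- z ≡ negₖ (shift v 0 ! z)
    paired z = begin
      shift v (toℕ j) ! ℤ.- + 1 ℤ.- z   ≡⟨ shift-! v (toℕ j) (ℤ.- + 1 ℤ.- z) ⟩
      v ! ℤ.- + 1 ℤ.- z ℤ.+ + toℕ j     ≡⟨ periodic-cong (shiftInvariant⇒periodic v p-inv) (ℤ.- q)
                                           (ℤ.- + 1 ℤ.+ t ℤ.- z) (unfold z (+ toℕ j) q (+ p)) ⟩
      v ! ℤ.- + 1 ℤ.+ t ℤ.- z           ≡⟨ reflect mirror z ⟩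
      negₖ (v ! z)                      ≡⟨ cong (λ w → negₖ (v ! w)) (ℤ.+-identityʳ z) ⟨
      negₖ (v ! z ℤ.+ + 0)              ≡⟨ cong negₖ (shift-! v 0 z) ⟨
      negₖ (shift v 0 ! z)              ∎
      where
      open ≡-Reasoning
      unfold : ∀ z j q p → ℤ.- + 1 ℤ.- z ℤ.+ j ≡ ℤ.- + 1 ℤ.+ (j ℤ.+ q ℤ.* p) ℤ.- z ℤ.+ (ℤ.- q) ℤ.* p
      unfold = solve-∀

containsNegaSym-≗ : ∀ {k m m′} (v : Vec (Fin k) (suc m)) (w : Vec (Fin k) (suc m′)) → (v !_) ≗ (w !_) →
                    ContainsNegaSym v → ContainsNegaSym w
containsNegaSym-≗ v w v≗w (_ , (p , isPeriod , j , j<p , refl) , ns) =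
  shift w j , (p , isPeriod-≗ v w v≗w isPeriod , j , j<p , refl) ,
  mirror⇒negaSym-shift w j (mirror-≗ v≗w (negaSym-shift⇒mirror v j ns))

-- Odd periods

odd-1+j+j : ∀ j → Odd (1 ℕ.+ j ℕ.+ j)
odd-1+j+j j 2∣1+j+j = contradiction (∣1⇒≡1 2∣1) λ ()
  where
  2∣j+j : 2 ∣ j ℕ.+ j
  2∣j+j = divides j (trans (cong (j ℕ.+_) (sym (ℕ.+-identityʳ j))) (ℕ.*-comm 2 j))
  2∣1 : 2 ∣ 1
  2∣1 = ∣m+n∣m⇒∣n (subst (2 ∣_) (ℕ.+-comm 1 (j ℕ.+ j)) 2∣1+j+j) 2∣j+j

∣1+j+j⇒odd : ∀ {p} j → p ∣ 1 ℕ.+ j ℕ.+ j → Odd p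
∣1+j+j⇒odd j p∣ 2∣p = odd-1+j+j j (∣-trans 2∣p p∣)

odd⇒coprime-2 : ∀ {p} → Odd p → Coprime p 2
odd⇒coprime-2 odd (d∣p , d∣2) with ∣⇒≤ d∣2
... | ℕ.z≤n               = contradiction (0∣⇒≡0 d∣2) λ ()
... | ℕ.s≤s ℕ.z≤n         = refl
... | ℕ.s≤s (ℕ.s≤s ℕ.z≤n) = contradiction d∣p odd

odd-∣-2^t* : ∀ {p c} → Odd p → ∀ t → p ∣ 2 ^ t * c → p ∣ c
odd-∣-2^t* {p} {c} odd zero    p∣ = subst (p ∣_) (ℕ.+-identityʳ c) p∣
odd-∣-2^t* {p} {c} odd (suc t) p∣ =
  odd-∣-2^t* odd t (coprime-divisor (odd⇒coprime-2 odd) (subst (p ∣_) (ℕ.*-assoc 2 (2 ^ t) c) p∣))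

1+j+j-unique≤ : ∀ {p j j′} → Odd p → p ∣ 1 ℕ.+ j ℕ.+ j → p ∣ 1 ℕ.+ j′ ℕ.+ j′ → j ≤ j′ → j′ < p → j ≡ j′
1+j+j-unique≤ {p} {j} {j′} odd p∣ p∣′ j≤j′ j′<p = begin
  j         ≡⟨ ℕ.+-identityʳ j ⟨
  j ℕ.+ 0   ≡⟨ cong (j ℕ.+_) δ≡0 ⟨
  j ℕ.+ δ   ≡⟨ ℕ.m+[n∸m]≡n j≤j′ ⟩
  j′        ∎
  where
  open ≡-Reasoning
  δ = j′ ∸ j
  split : 1 ℕ.+ j′ ℕ.+ j′ ≡ (1 ℕ.+ j ℕ.+ j) ℕ.+ 2 * δ
  split = trans (cong (λ w → 1 ℕ.+ w ℕ.+ w) (sym (ℕ.m+[n∸m]≡n j≤j′))) (regroup j δ)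
    where
    regroup : ∀ j δ → 1 ℕ.+ (j ℕ.+ δ) ℕ.+ (j ℕ.+ δ) ≡ (1 ℕ.+ j ℕ.+ j) ℕ.+ 2 * δ
    regroup = ℕ-Solver.solve-∀
  δ≡0 : δ ≡ 0
  δ≡0 = ∣∧<⇒≡0 (coprime-divisor (odd⇒coprime-2 odd) (∣m+n∣m⇒∣n (subst (p ∣_) split p∣′) p∣))
               (ℕ.≤-<-trans (ℕ.m∸n≤m j′ j) j′<p)

1+j+j-unique : ∀ {p j j′} → Odd p → p ∣ 1 ℕ.+ j ℕ.+ j → p ∣ 1 ℕ.+ j′ ℕ.+ j′ → j < p → j′ < p → j ≡ j′
1+j+j-unique {j = j} {j′} odd p∣ p∣′ j<p j′<p with ℕ.≤-total j j′
... | inj₁ j≤j′ = 1+j+j-unique≤ odd p∣ p∣′ j≤j′ j′<p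
... | inj₂ j′≤j = sym (1+j+j-unique≤ odd p∣′ p∣ j′≤j j<p)

module _ {k m : ℕ} (v : Vec (Fin k) (suc m)) (mirror : MirrorSymmetric negₖ (v !_) (ℤ.- + 2)) where

  period-∣-1+j+j : ∀ {p j} → IsPeriod v p → NegaSym (shift v j) → p ∣ 1 ℕ.+ j ℕ.+ j
  period-∣-1+j+j {p} {j} isPeriod ns =
    period-∣ v isPeriod
      (subst (Periodic (v !_)) (width (+ j)) (mirrors⇒periodic (negaSym-shift⇒mirror v j ns) mirror))
    where
    width : ∀ j → (ℤ.- + 1 ℤ.+ j ℤ.+ j) ℤ.- (ℤ.- + 2) ≡ + 1 ℤ.+ j ℤ.+ j
    width = solve-∀

  containsNegaSym⇒oddPeriod : ContainsNegaSym v → ∃ λ p → IsPeriod v p × Odd p × p ∣ suc m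
  containsNegaSym⇒oddPeriod (_ , (p , isPeriod , j , _ , refl) , ns) =
    p , isPeriod , ∣1+j+j⇒odd j (period-∣-1+j+j isPeriod ns) , period-∣ v isPeriod (!-periodic v)

  containsNegaSym⇒exactlyOne : ContainsNegaSym v → ExactlyOneNegaSym v
  containsNegaSym⇒exactlyOne (e , inCircuit@(p , isPeriod , j , j<p , refl) , ns) =
    e , inCircuit , ns , unique
    where
    unique : ∀ f → InCircuit f v → NegaSym f → f ≡ e
    unique f (p′ , isPeriod′ , j′ , j′<p′ , refl) ns′ with period-unique v isPeriod isPeriod′
    ... | refl = cong (shift v) (sym (1+j+j-unique (∣1+j+j⇒odd j p∣) p∣ p∣′ j<p j′<p′))
      where
      p∣ = period-∣-1+j+j isPeriod ns
      p∣′ = period-∣-1+j+j isPeriod ns′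

module _ {k m : ℕ} (a : Vec (Fin k) m) (x : Fin k) where

  private
    A = a ∷ʳ x

  ∷ʳ-mirror : NegaSym a → negₖ x ≡ x → MirrorSymmetric negₖ (A !_) (ℤ.- + 2)
  ∷ʳ-mirror ns fixed = mirror-from-lookup A mirror-entry
    where
    open ≡-Reasoning
    mirror-entry : ∀ i → A ! ℤ.- + 2 ℤ.- + toℕ i ≡ negₖ (lookup A i)
    mirror-entry i with view i
    ... | ‵fromℕ = begin
      A ! ℤ.- + 2 ℤ.- + toℕ (fromℕ m)   ≡⟨ cong (λ r → A ! ℤ.- + 2 ℤ.- + r) (Fin.toℕ-fromℕ m) ⟩
      A ! ℤ.- + 2 ℤ.- + m               ≡⟨ periodic-cong (!-periodic A) (ℤ.- + 1) (ℤ.- + 1) (wrap (+ m)) ⟩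
      A ! ℤ.- + 1                       ≡⟨ !-last A ⟩
      lookup A (fromℕ m)                ≡⟨ lookup-∷ʳ-fromℕ a x ⟩
      x                                 ≡⟨ fixed ⟨
      negₖ x                            ≡⟨ cong negₖ (lookup-∷ʳ-fromℕ a x) ⟨
      negₖ (lookup A (fromℕ m))         ∎
      where
      wrap : ∀ r → ℤ.- + 2 ℤ.- r ≡ ℤ.- + 1 ℤ.+ ℤ.- + 1 ℤ.* (+ 1 ℤ.+ r)
      wrap = solve-∀
    ... | ‵inject₁ j = begin
      A ! ℤ.- + 2 ℤ.- + toℕ (inject₁ j)         ≡⟨ cong (λ r → A ! ℤ.- + 2 ℤ.- + r) (Fin.toℕ-inject₁ j) ⟩
      A ! ℤ.- + 2 ℤ.- + toℕ j                   ≡⟨ cong (A !_) (step-out (+ toℕ j)) ⟩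
      A ! ℤ.- + 1 ℤ.- + toℕ (Fin.suc j)         ≡⟨ !-opposite A (Fin.suc j) ⟩
      A ! + toℕ (inject₁ (opposite j))          ≡⟨ lookup-! A (inject₁ (opposite j)) ⟨
      lookup A (inject₁ (opposite j))           ≡⟨ lookup-∷ʳ-inject₁ a x (opposite j) ⟩
      lookup a (opposite j)                     ≡⟨ negaSym-lookup ns (opposite j) ⟩
      negₖ (lookup a (opposite (opposite j)))   ≡⟨ cong (negₖ ∘ lookup a) (Fin.opposite-involutive j) ⟩
      negₖ (lookup a j)                         ≡⟨ cong negₖ (lookup-∷ʳ-inject₁ a x j) ⟨
      negₖ (lookup A (inject₁ j))               ∎
      where
      step-out : ∀ r → ℤ.- + 2 ℤ.- r ≡ ℤ.- + 1 ℤ.- (+ 1 ℤ.+ r)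
      step-out = solve-∀

-- Pseudoweight

sum-∷ʳ : ∀ {l} (ns : Vec ℕ l) n → Vec.sum (ns ∷ʳ n) ≡ Vec.sum ns ℕ.+ n
sum-∷ʳ []        n = ℕ.+-comm n 0
sum-∷ʳ (n′ ∷ ns) n = trans (cong (n′ ℕ.+_) (sum-∷ʳ ns n)) (sym (ℕ.+-assoc n′ (Vec.sum ns) n))

sum-reverse : ∀ {l} (ns : Vec ℕ l) → Vec.sum (reverse ns) ≡ Vec.sum ns
sum-reverse []       = refl
sum-reverse (n ∷ ns) = begin
  Vec.sum (reverse (n ∷ ns))   ≡⟨ cong Vec.sum (Vec.reverse-∷ n ns) ⟩
  Vec.sum (reverse ns ∷ʳ n)    ≡⟨ sum-∷ʳ (reverse ns) n ⟩
  Vec.sum (reverse ns) ℕ.+ n   ≡⟨ cong (ℕ._+ n) (sum-reverse ns) ⟩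
  Vec.sum ns ℕ.+ n             ≡⟨ ℕ.+-comm (Vec.sum ns) n ⟩
  n ℕ.+ Vec.sum ns             ∎
  where open ≡-Reasoning

module _ {k′ : ℕ} where

  private
    k = suc k′

  ZeroOrHalf : Fin k → Set
  ZeroOrHalf x = toℕ x ≡ 0 ⊎ (Even k × 2 * toℕ x ≡ k)

  negₖ-fixed : ∀ {x} → ZeroOrHalf x → negₖ x ≡ x
  negₖ-fixed {x} (inj₁ x≡0) = Fin.toℕ-injective (begin
    toℕ (negₖ x)        ≡⟨ Fin.toℕ-fromℕ< _ ⟩
    (k ∸ toℕ x) ℕ.% k   ≡⟨ cong (λ r → (k ∸ r) ℕ.% k) x≡0 ⟩
    k ℕ.% k             ≡⟨ ℕ.n%n≡0 k ⟩
    0                   ≡⟨ x≡0 ⟨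
    toℕ x               ∎)
    where open ≡-Reasoning
  negₖ-fixed {x} (inj₂ (_ , 2x≡k)) = Fin.toℕ-injective (begin
    toℕ (negₖ x)                      ≡⟨ Fin.toℕ-fromℕ< _ ⟩
    (k ∸ toℕ x) ℕ.% k                 ≡⟨ cong (λ r → (r ∸ toℕ x) ℕ.% k) x+x≡k ⟨
    (toℕ x ℕ.+ toℕ x ∸ toℕ x) ℕ.% k   ≡⟨ cong (ℕ._% k) (ℕ.m+n∸n≡m (toℕ x) (toℕ x)) ⟩
    toℕ x ℕ.% k                       ≡⟨ ℕ.m<n⇒m%n≡m (Fin.toℕ<n x) ⟩
    toℕ x                             ∎)
    where
    open ≡-Reasoning
    x+x≡k : toℕ x ℕ.+ toℕ x ≡ k
    x+x≡k = trans (cong (toℕ x ℕ.+_) (sym (ℕ.+-identityʳ (toℕ x)))) 2x≡k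

  pw2-fixed : ∀ {x} → ZeroOrHalf x → pw2 x ≡ k
  pw2-fixed {Fin.zero}  _                 = refl
  pw2-fixed {Fin.suc _} (inj₂ (_ , 2x≡k)) = 2x≡k

  pw2-positive : ∀ (y : Fin k) → 0 < toℕ y → pw2 y ≡ 2 * toℕ y
  pw2-positive (Fin.suc _) _ = refl

  toℕ-negₖ-suc : ∀ (i : Fin k′) → toℕ (negₖ {k} (Fin.suc i)) ≡ k′ ∸ toℕ i
  toℕ-negₖ-suc i = trans (Fin.toℕ-fromℕ< _) (ℕ.m<n⇒m%n≡m (ℕ.s≤s (ℕ.m∸n≤m k′ (toℕ i))))

  pw2-+-negₖ : ∀ (y : Fin k) → pw2 y ℕ.+ pw2 (negₖ y) ≡ 2 * k
  pw2-+-negₖ Fin.zero = begin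
    k ℕ.+ pw2 (negₖ {k} Fin.zero)   ≡⟨ cong (λ y → k ℕ.+ pw2 y) (negₖ-fixed (inj₁ refl)) ⟩
    k ℕ.+ k                         ≡⟨ cong (k ℕ.+_) (ℕ.+-identityʳ k) ⟨
    2 * k                           ∎
    where open ≡-Reasoning
  pw2-+-negₖ (Fin.suc i) = begin
    pw2 (Fin.suc i) ℕ.+ pw2 (negₖ (Fin.suc i))
      ≡⟨ cong (pw2 (Fin.suc i) ℕ.+_) (pw2-positive (negₖ (Fin.suc i)) positive) ⟩
    2 * suc (toℕ i) ℕ.+ 2 * toℕ (negₖ (Fin.suc i))
      ≡⟨ cong (λ r → 2 * suc (toℕ i) ℕ.+ 2 * r) (toℕ-negₖ-suc i) ⟩
    2 * suc (toℕ i) ℕ.+ 2 * (k′ ∸ toℕ i)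
      ≡⟨ ℕ.*-distribˡ-+ 2 (suc (toℕ i)) (k′ ∸ toℕ i) ⟨
    2 * suc (toℕ i ℕ.+ (k′ ∸ toℕ i))
      ≡⟨ cong (λ r → 2 * suc r) (ℕ.m+[n∸m]≡n (ℕ.<⇒≤ (Fin.toℕ<n i))) ⟩
    2 * k
      ∎
    where
    open ≡-Reasoning
    positive : 0 < toℕ (negₖ {k} (Fin.suc i))
    positive = subst (0 <_) (sym (toℕ-negₖ-suc i)) (ℕ.m<n⇒0<n∸m (Fin.toℕ<n i))

  pw2T-+-negT : ∀ {l} (u : Vec (Fin k) l) → pw2T u ℕ.+ pw2T (negT u) ≡ l * (2 * k)
  pw2T-+-negT []      = refl
  pw2T-+-negT (y ∷ u) = trans (interchange (pw2 y) (pw2T u) (pw2 (negₖ y)) (pw2T (negT u)))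
                              (cong₂ ℕ._+_ (pw2-+-negₖ y) (pw2T-+-negT u))
    where
    interchange : ∀ a b c d → (a ℕ.+ b) ℕ.+ (c ℕ.+ d) ≡ (a ℕ.+ c) ℕ.+ (b ℕ.+ d)
    interchange = ℕ-Solver.solve-∀

  pw2T-reverse : ∀ {l} (u : Vec (Fin k) l) → pw2T (reverse u) ≡ pw2T u
  pw2T-reverse u = trans (cong Vec.sum (Vec.map-reverse pw2 u)) (sum-reverse (Vec.map pw2 u))

  pw2T-negaSym : ∀ {l} {a : Vec (Fin k) l} → NegaSym a → pw2T a ≡ l * k
  pw2T-negaSym {l} {a} ns = ℕ.*-cancelˡ-≡ (pw2T a) (l * k) 2 (begin
    2 * pw2T a                 ≡⟨ cong (pw2T a ℕ.+_) (ℕ.+-identityʳ (pw2T a)) ⟩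
    pw2T a ℕ.+ pw2T a          ≡⟨ cong (pw2T a ℕ.+_) pw2T-a≡pw2T-negT ⟩
    pw2T a ℕ.+ pw2T (negT a)   ≡⟨ pw2T-+-negT a ⟩
    l * (2 * k)                ≡⟨ regroup l k ⟩
    2 * (l * k)                ∎)
    where
    open ≡-Reasoning
    regroup : ∀ l k → l * (2 * k) ≡ 2 * (l * k)
    regroup = ℕ-Solver.solve-∀
    pw2T-a≡pw2T-negT : pw2T a ≡ pw2T (negT a)
    pw2T-a≡pw2T-negT = begin
      pw2T a                    ≡⟨ cong pw2T ns ⟩
      pw2T (negT (reverse a))   ≡⟨ cong pw2T (Vec.map-reverse negₖ a) ⟩
      pw2T (reverse (negT a))   ≡⟨ pw2T-reverse (negT a) ⟩
      pw2T (negT a)             ∎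

  pw2T-∷ʳ : ∀ {l} {a : Vec (Fin k) l} {x} → NegaSym a → ZeroOrHalf x → pw2T (a ∷ʳ x) ≡ k * suc l
  pw2T-∷ʳ {l} {a} {x} ns x-fixed = begin
    pw2T (a ∷ʳ x)                      ≡⟨ cong Vec.sum (Vec.map-∷ʳ pw2 x a) ⟩
    Vec.sum (Vec.map pw2 a ∷ʳ pw2 x)   ≡⟨ sum-∷ʳ (Vec.map pw2 a) (pw2 x) ⟩
    pw2T a ℕ.+ pw2 x                   ≡⟨ cong₂ ℕ._+_ (pw2T-negaSym ns) (pw2-fixed x-fixed) ⟩
    l * k ℕ.+ k                        ≡⟨ regroup l k ⟩
    k * suc l                          ∎
    where
    open ≡-Reasoning
    regroup : ∀ l k → l * k ℕ.+ k ≡ k * (1 ℕ.+ l)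
    regroup = ℕ-Solver.solve-∀

-- Repeating the period

module _ {X : Set} where

  toList-tabulate : ∀ n (g : ℕ → X) → toList (tabulate {n = n} (g ∘ toℕ)) ≡ applyUpTo g n
  toList-tabulate zero    g = refl
  toList-tabulate (suc n) g = cong (g 0 ∷_) (toList-tabulate n (g ∘ suc))

  applyUpTo-cong : ∀ {g h : ℕ → X} → g ≗ h → ∀ n → applyUpTo g n ≡ applyUpTo h n
  applyUpTo-cong g≗h zero    = refl
  applyUpTo-cong g≗h (suc n) = cong₂ _∷_ (g≗h 0) (applyUpTo-cong (g≗h ∘ suc) n)

  applyUpTo-+ : ∀ (g : ℕ → X) a b →
                applyUpTo g (a ℕ.+ b) ≡ applyUpTo g a ++ applyUpTo (λ r → g (a ℕ.+ r)) b
  applyUpTo-+ g zero    b = refl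
  applyUpTo-+ g (suc a) b = cong (g 0 ∷_) (applyUpTo-+ (g ∘ suc) a b)

  applyUpTo-periodic : ∀ {g : ℕ → X} {c} → (∀ r → g (c ℕ.+ r) ≡ g r) → ∀ q →
                       applyUpTo g (q * c) ≡ concat (replicate q (applyUpTo g c))
  applyUpTo-periodic         per zero    = refl
  applyUpTo-periodic {g} {c} per (suc q) = begin
    applyUpTo g (c ℕ.+ q * c)
      ≡⟨ applyUpTo-+ g c (q * c) ⟩
    applyUpTo g c ++ applyUpTo (λ r → g (c ℕ.+ r)) (q * c)
      ≡⟨ cong (applyUpTo g c ++_) (applyUpTo-cong per (q * c)) ⟩
    applyUpTo g c ++ applyUpTo g (q * c)
      ≡⟨ cong (applyUpTo g c ++_) (applyUpTo-periodic per q) ⟩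
    applyUpTo g c ++ concat (replicate q (applyUpTo g c))
      ∎
    where open ≡-Reasoning

  last-applyUpTo : ∀ (g : ℕ → X) l → last (applyUpTo g (suc l)) ≡ just (g l)
  last-applyUpTo g zero    = refl
  last-applyUpTo g (suc l) = last-applyUpTo (g ∘ suc) l

  prefix : ∀ {m} → Vec X (suc m) → (c : ℕ) → Vec X c
  prefix v c = tabulate (λ i → v ! + toℕ i)

  module _ {m : ℕ} (v : Vec X (suc m)) where

    toList-! : toList v ≡ applyUpTo (λ r → v ! + r) (suc m)
    toList-! = begin
      toList v                                ≡⟨ cong toList (Vec.tabulate∘lookup v) ⟨
      toList (tabulate (lookup v))            ≡⟨ cong toList (Vec.tabulate-cong (lookup-! v)) ⟩
      toList (tabulate (λ i → v ! + toℕ i))   ≡⟨ toList-tabulate (suc m) (λ r → v ! + r) ⟩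
      applyUpTo (λ r → v ! + r) (suc m)       ∎
      where open ≡-Reasoning

    prefix-! : ∀ {c} → Periodic (v !_) (+ suc c) → ∀ z → prefix v (suc c) ! z ≡ v ! z
    prefix-! {c} per z with decompose {suc c} z
    ... | i , q , refl = begin
      w ! + toℕ i ℤ.+ q ℤ.* + suc c   ≡⟨ periodic-* (!-periodic w) q (+ toℕ i) ⟩
      w ! + toℕ i                     ≡⟨ lookup-! w i ⟨
      lookup w i                      ≡⟨ Vec.lookup∘tabulate (λ i → v ! + toℕ i) i ⟩
      v ! + toℕ i                     ≡⟨ periodic-* per q (+ toℕ i) ⟨
      v ! + toℕ i ℤ.+ q ℤ.* + suc c   ∎
      where
      open ≡-Reasoning
      w = prefix v (suc c)

    last-prefix : ∀ {c} → Periodic (v !_) (+ suc c) →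
                  last (toList (prefix v (suc c))) ≡ just (v ! ℤ.- + 1)
    last-prefix {c} per = begin
      last (toList (prefix v (suc c)))           ≡⟨ cong last (toList-tabulate (suc c) (λ r → v ! + r)) ⟩
      last (applyUpTo (λ r → v ! + r) (suc c))   ≡⟨ last-applyUpTo (λ r → v ! + r) c ⟩
      just (v ! + c)                             ≡⟨ cong just (per (ℤ.- + 1)) ⟩
      just (v ! ℤ.- + 1)                         ∎
      where open ≡-Reasoning

    toList-periodic : ∀ {c} q → Periodic (v !_) (+ c) → suc m ≡ q * c →
                      toList v ≡ concat (replicate q (toList (prefix v c)))
    toList-periodic {c} q per m+1≡ = begin
      toList v                                     ≡⟨ toList-! ⟩
      applyUpTo g (suc m)                          ≡⟨ cong (applyUpTo g) m+1≡ ⟩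
      applyUpTo g (q * c)                          ≡⟨ applyUpTo-periodic g-periodic q ⟩
      concat (replicate q (applyUpTo g c))         ≡⟨ cong (concat ∘ replicate q) (toList-tabulate c g) ⟨
      concat (replicate q (toList (prefix v c)))   ∎
      where
      open ≡-Reasoning
      g : ℕ → X
      g r = v ! + r
      g-periodic : ∀ r → g (c ℕ.+ r) ≡ g r
      g-periodic r = trans (cong (λ w → v ! + w) (ℕ.+-comm c r)) (per (+ r))

lemma4p10 : (k n t c : ℕ) → 3 ≤ k → 4 ≤ n → 0 < t → Odd c → n ≡ 2 ^ t * c →
    (a : Vec (Fin k) (n ∸ 1)) → NegaSym a →
    (x : Fin k) → (toℕ x ≡ 0 ⊎ (Even k × 2 * toℕ x ≡ k)) →
    (NegaSymCircuit (a ∷ʳ x) × InC n (a ∷ʳ x))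
    × (ContainsNegaSym (a ∷ʳ x) →
        (Σ ℕ λ p → IsPeriod (a ∷ʳ x) p × Odd p × p ∣ c)
        × ExactlyOneNegaSym (a ∷ʳ x)
        × (Σ (Vec (Fin k) c) λ b →
            last (toList b) ≡ just x
            × toList (a ∷ʳ x) ≡ concat (replicate (2 ^ t) (toList b))
            × NegaSymCircuit b × ExactlyOneNegaSym b))
lemma4p10 (suc _) (suc _) t zero _ _ _ _ n≡2ᵗc = contradiction (trans n≡2ᵗc (ℕ.*-zeroʳ (2 ^ t))) λ ()
lemma4p10 k@(suc _) n@(suc _) t c@(suc _) _ _ _ _ n≡2ᵗc a ns x x-fixed =
  (mirror⇒negaSymCircuit A (ℤ.- + 1) mirror , A , pw2T-∷ʳ ns x-fixed , λ _ → mk⇔ id id) ,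
  λ contains →
    let p , isPeriod@(_ , p-inv , _) , odd-p , p∣n = containsNegaSym⇒oddPeriod A mirror contains
        p∣c : p ∣ c
        p∣c = odd-∣-2^t* odd-p t (subst (p ∣_) n≡2ᵗc p∣n)
        c-periodic : Periodic (A !_) (+ c)
        c-periodic = periodic-∣ (shiftInvariant⇒periodic A p-inv) p∣c
        b : Vec (Fin k) c
        b = prefix A c
        A≗b : (A !_) ≗ (b !_)
        A≗b z = sym (prefix-! A c-periodic z)
        b-mirror : MirrorSymmetric negₖ (b !_) (ℤ.- + 2)
        b-mirror = mirror-≗ A≗b mirror
    in (p , isPeriod , odd-p , p∣c) ,
       containsNegaSym⇒exactlyOne A mirror contains ,
       b ,
       trans (last-prefix A c-periodic) (cong just (trans (!-last A) (lookup-∷ʳ-fromℕ a x))) ,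
       toList-periodic A (2 ^ t) c-periodic n≡2ᵗc ,
       mirror⇒negaSymCircuit b (ℤ.- + 1) b-mirror ,
       containsNegaSym⇒exactlyOne b b-mirror (containsNegaSym-≗ A b A≗b contains)
  where
  A : Vec (Fin k) n
  A = a ∷ʳ x
  mirror : MirrorSymmetric negₖ (A !_) (ℤ.- + 2)
  mirror = ∷ʳ-mirror a x ns (negₖ-fixed x-fixed)
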